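{- For every non-negative integer $n$, \[ \sum_{k=0}^n (-1)^k 2^{n-k} L_{k+1} = (-1)^{n} F_{n+1}, \] where $(F_m)_{m\ge 0}$ are the Fibonacci numbers and $(L_m)_{m\ge 0}$ are the Lucas numbers.
   Context: The Fibonacci numbers are defined by $F_0=0$, $F_1=1$, $F_{m+2}=F_{m+1}+F_m$ for $m\ge 0$. The Lucas numbers are defined by $L_0=2$, $L_1=1$, $L_{m+2}=L_{m+1}+L_m$ for $m\ge 0$. -}

module Defs where

open import Data.Nat using (ℕ; zero; suc; _∸_; _^_)
open import Data.Integer using (ℤ; +_; -_; _+_; _*_)

F : ℕ → ℕ
F zero = 0
F (suc zero) = 1
F (suc (suc m)) = F (suc m) Data.Nat.+ F m

L : ℕ → ℕ
L zero = 2
L (suc zero) = 1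
L (suc (suc m)) = L (suc m) Data.Nat.+ L m

sgn : ℕ → ℤ
sgn zero = + 1
sgn (suc k) = - sgn k

sumTo : ℕ → (ℕ → ℤ) → ℤ
sumTo zero f = f 0
sumTo (suc n) f = sumTo n f + f (suc n)

-- Multiplying by 2^(n+1-k) instead of 2^(n-k) doubles the first n+1 terms of the sum,
-- so S(n+1) = 2 S(n) + (-1)^(n+1) L(n+2).  Together with L(m+1) = F(m+1) + 2 F(m)
-- this turns the claim S(n) = (-1)^n F(n+1) into the Fibonacci recurrence.
module Submission where

open import Defs
open import Data.Nat using (ℕ; zero; suc; _∸_; _^_; _≤_; z≤n)
import Data.Nat as ℕ
import Data.Nat.Properties as ℕ
open import Data.Integer using (ℤ; +_; -_; _+_; _*_)
open import Data.Integer.Properties using (pos-+; pos-*; *-identityˡ; *-distribˡ-+)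
import Data.Integer.Solver as ℤ-Solver
import Data.Nat.Solver as ℕ-Solver
open import Relation.Binary.PropositionalEquality

sumTo-cong : ∀ n {f g : ℕ → ℤ} → (∀ k → k ≤ n → f k ≡ g k) → sumTo n f ≡ sumTo n g
sumTo-cong zero    f≗g = f≗g 0 z≤n
sumTo-cong (suc n) f≗g =
  cong₂ _+_ (sumTo-cong n (λ k k≤n → f≗g k (ℕ.m≤n⇒m≤1+n k≤n))) (f≗g (suc n) ℕ.≤-refl)

sumTo-*ˡ : ∀ n c (f : ℕ → ℤ) → sumTo n (λ k → c * f k) ≡ c * sumTo n f
sumTo-*ˡ zero    c f = refl
sumTo-*ˡ (suc n) c f = begin
  sumTo n (λ k → c * f k) + c * f (suc n) ≡⟨ cong (_+ c * f (suc n)) (sumTo-*ˡ n c f) ⟩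
  c * sumTo n f + c * f (suc n)           ≡⟨ *-distribˡ-+ c (sumTo n f) (f (suc n)) ⟨
  c * (sumTo n f + f (suc n))             ∎
  where open ≡-Reasoning

sumTo-2^-step : ∀ n (a b : ℕ → ℤ) →
  sumTo (suc n) (λ k → a k * (+ (2 ^ (suc n ∸ k)) * b k)) ≡
  + 2 * sumTo n (λ k → a k * (+ (2 ^ (n ∸ k)) * b k)) + a (suc n) * b (suc n)
sumTo-2^-step n a b = cong₂ _+_ doubled last
  where
  open ≡-Reasoning
  open ℤ-Solver.+-*-Solver
  double : ∀ k → k ≤ n →
    a k * (+ (2 ^ (suc n ∸ k)) * b k) ≡ + 2 * (a k * (+ (2 ^ (n ∸ k)) * b k))
  double k k≤n = begin
    a k * (+ (2 ^ (suc n ∸ k)) * b k)    ≡⟨ cong (λ e → a k * (+ (2 ^ e) * b k)) (ℕ.+-∸-assoc 1 k≤n) ⟩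
    a k * (+ (2 ℕ.* 2 ^ (n ∸ k)) * b k)  ≡⟨ cong (λ p → a k * (p * b k)) (pos-* 2 (2 ^ (n ∸ k))) ⟩
    a k * (+ 2 * + (2 ^ (n ∸ k)) * b k)  ≡⟨ solve 3 (λ x p y → x :* ((con (+ 2) :* p) :* y) := con (+ 2) :* (x :* (p :* y)))
                                              refl (a k) (+ (2 ^ (n ∸ k))) (b k) ⟩
    + 2 * (a k * (+ (2 ^ (n ∸ k)) * b k)) ∎
  doubled : sumTo n (λ k → a k * (+ (2 ^ (suc n ∸ k)) * b k)) ≡
            + 2 * sumTo n (λ k → a k * (+ (2 ^ (n ∸ k)) * b k))
  doubled = trans (sumTo-cong n double) (sumTo-*ˡ n (+ 2) _)
  last : a (suc n) * (+ (2 ^ (suc n ∸ suc n)) * b (suc n)) ≡ a (suc n) * b (suc n)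
  last rewrite ℕ.n∸n≡0 n = cong (a (suc n) *_) (*-identityˡ (b (suc n)))

L-suc≡F-suc+2F : ∀ m → L (suc m) ≡ F (suc m) ℕ.+ 2 ℕ.* F m
L-suc≡F-suc+2F zero          = refl
L-suc≡F-suc+2F (suc zero)    = refl
L-suc≡F-suc+2F (suc (suc m))
  rewrite L-suc≡F-suc+2F (suc m) | L-suc≡F-suc+2F m =
    regroup (F (suc (suc m))) (F (suc m)) (F m)
  where
  open ℕ-Solver.+-*-Solver
  regroup : ∀ x y z → (x ℕ.+ 2 ℕ.* y) ℕ.+ (y ℕ.+ 2 ℕ.* z) ≡ (x ℕ.+ y) ℕ.+ 2 ℕ.* (y ℕ.+ z)
  regroup = solve 3 (λ x y z →
    (x :+ con 2 :* y) :+ (y :+ con 2 :* z) := (x :+ y) :+ con 2 :* (y :+ z)) refl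

+L-suc≡+F-suc+2F : ∀ m → + L (suc m) ≡ + F (suc m) + + 2 * + F m
+L-suc≡+F-suc+2F m = begin
  + L (suc m)                     ≡⟨ cong +_ (L-suc≡F-suc+2F m) ⟩
  + (F (suc m) ℕ.+ 2 ℕ.* F m)     ≡⟨ pos-+ (F (suc m)) (2 ℕ.* F m) ⟩
  + F (suc m) + + (2 ℕ.* F m)     ≡⟨ cong (_+_ (+ F (suc m))) (pos-* 2 (F m)) ⟩
  + F (suc m) + + 2 * + F m       ∎
  where open ≡-Reasoning

theorem1 : (n : ℕ) →
    sumTo n (λ k → sgn k * (+ (2 ^ (n ∸ k)) * + L (suc k))) ≡ sgn n * + F (suc n)
theorem1 zero    = refl
theorem1 (suc n) = begin
  sumTo (suc n) (λ k → sgn k * (+ (2 ^ (suc n ∸ k)) * + L (suc k)))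
    ≡⟨ sumTo-2^-step n sgn (λ k → + L (suc k)) ⟩
  + 2 * sumTo n (λ k → sgn k * (+ (2 ^ (n ∸ k)) * + L (suc k))) + - s * + L (suc (suc n))
    ≡⟨ cong₂ (λ x y → + 2 * x + - s * y) (theorem1 n) (+L-suc≡+F-suc+2F (suc n)) ⟩
  + 2 * (s * + F (suc n)) + - s * (+ F (suc (suc n)) + + 2 * + F (suc n))
    ≡⟨ solve 3 (λ s x y → con (+ 2) :* (s :* y) :+ (:- s) :* (x :+ con (+ 2) :* y) := (:- s) :* x)
         refl s (+ F (suc (suc n))) (+ F (suc n)) ⟩
  - s * + F (suc (suc n)) ∎
  where
  open ≡-Reasoning
  open ℤ-Solver.+-*-Solver
  s : ℤ
  s = sgn n
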